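{- For all nonnegative integers $n$ and $r$, $${}_rF_{n+r}(x)=x^{r}r!\sum_{k=0}^{n}\binom{n}{k}r^{n-k}F_{k,r+1}(x),$$ with the convention $0^0=1$.
   Context: $\left\{ {n \atop k}\right\}$ are Stirling numbers of the second kind; for $\beta>0$ the general geometric polynomials are $F_{n,\beta}(x)=\frac{1}{\Gamma(\beta)}\sum_{k=0}^{n}\left\{ {n \atop k}\right\}\Gamma(k+\beta)x^k$. The $r$-Stirling numbers of the second kind $\left\{ {n \atop k}\right\}_r$ count partitions of $\{1,\dots,n\}$ into $k$ nonempty blocks with $1,\dots,r$ in distinct blocks (vanishing for $n<r$, equal to $\delta_{k,r}$ for $n=r$, and satisfying $\left\{ {n \atop k}\right\}_r=\left\{ {n-1 \atop k-1}\right\}_r+k\left\{ {n-1 \atop k}\right\}_r$ for $n>r$). The $r$-geometric polynomials are ${}_rF_n(x)=\sum_{k=0}^{n}\left\{ {n \atop k}\right\}_r k!\,x^k$. -}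

module Defs where

open import Level using (Level)
open import Data.Nat using (ℕ; zero; suc; _+_; _*_; _∸_; _<ᵇ_; _!)
open import Data.Bool using (if_then_else_)
open import Algebra.Bundles using (CommutativeSemiring)
import Algebra.Definitions.RawSemiring as RS

stirling : ℕ → ℕ → ℕ
stirling zero    zero    = 1
stirling zero    (suc k) = 0
stirling (suc n) zero    = 0
stirling (suc n) (suc k) = stirling n k + suc k * stirling n (suc k)

δ : ℕ → ℕ → ℕ
δ zero    zero    = 1
δ zero    (suc k) = 0
δ (suc m) zero    = 0
δ (suc m) (suc k) = δ m k

-- rStirlingAux r m k = {m + r  k}_r
rStirlingAux : ℕ → ℕ → ℕ → ℕ
rStirlingAux r zero    k       = δ k r
rStirlingAux r (suc m) zero    = 0
rStirlingAux r (suc m) (suc k) = rStirlingAux r m k + suc k * rStirlingAux r m (suc k)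

-- r-Stirling numbers of the second kind {n k}_r:
-- 0 for n < r, δ_{k,r} for n = r, and
-- {n k}_r = {n-1 k-1}_r + k {n-1 k}_r for n > r (with {n-1 -1}_r = 0).
rStirling : ℕ → ℕ → ℕ → ℕ
rStirling r n k = if n <ᵇ r then 0 else rStirlingAux r (n ∸ r) k

rising : ℕ → ℕ → ℕ
rising β zero    = 1
rising β (suc k) = rising β k * (β + k)

module _ {c ℓ : Level} (R : CommutativeSemiring c ℓ) where
  open CommutativeSemiring R renaming (_+_ to _⊕_; _*_ to _⊛_)
  open RS rawSemiring using (_×_; _^_)

  sumTo : ℕ → (ℕ → Carrier) → Carrier
  sumTo zero    f = f 0
  sumTo (suc n) f = sumTo n f ⊕ f (suc n)

  -- general geometric polynomial F_{n,β}(x) for a positive integer β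
  -- (Γ(k+β)/Γ(β) is the rising factorial β^(k)); evaluated at x ∈ R
  geomF : ℕ → ℕ → Carrier → Carrier
  geomF n β x = sumTo n (λ k → (stirling n k * rising β k) × (x ^ k))

  rGeomF : ℕ → ℕ → Carrier → Carrier
  rGeomF r n x = sumTo n (λ k → (rStirling r n k * k !) × (x ^ k))

-- The combinatorial heart is the identity
--     {n+r  j+r}_r = Σ_{k≤n} C(n,k) r^{n-k} {k  j}.                          (★)
-- Write  b_n(a) = Σ_{k≤n} C(n,k) r^{n-k} a_k  for the binomial transform of a
-- sequence a.  Pascal's rule gives  b_{n+1}(a) = r·b_n(a) + b_n(a ∘ suc),  and
-- feeding the Stirling recurrence {k+1 j+1} = {k j} + (j+1){k j+1} into it
-- shows that the right side of (★) satisfies the r-Stirling recurrence with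
-- weight j+1+r; both sides also agree at n = 0, whence (★).
--
-- Together with  r!·(r+1)^(j) = (j+r)!  (rising factorial), the vanishing of
-- {n+r k}_r for k < r and of {k j} for j > k, both sides of the theorem become
-- Σ_{j≤n} ({n+r j+r}_r (j+r)!) x^{j+r}.
module Submission where

open import Defs
open import Level using (Level)
open import Data.Nat using (ℕ; suc; _+_; _*_; _∸_; _!)
open import Data.Nat.Combinatorics using (_C_)
open import Algebra.Bundles using (CommutativeSemiring)
import Data.Nat as N
import Algebra.Definitions.RawSemiring as RS
import Data.Nat.Properties as NP
open import Relation.Binary.PropositionalEquality as P using (_≡_)

module FiniteSums {c ℓ : Level} (R : CommutativeSemiring c ℓ) where
  open CommutativeSemiring R renaming (_+_ to _⊕_; _*_ to _⊛_)
  open RS rawSemiring using (_×_)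
  open N using (zero; _≤_; _<_; z≤n; s≤s)
  open import Algebra.Properties.Semiring.Mult semiring using (×-homo-+)
  open import Algebra.Properties.CommutativeMonoid.Mult +-commutativeMonoid using (×-distrib-+)
  open import Algebra.Properties.CommutativeSemigroup +-commutativeSemigroup using (interchange)

  Σ≤ : ℕ → (ℕ → Carrier) → Carrier
  Σ≤ = sumTo R

  sum-cong : ∀ n {f g} → (∀ k → k ≤ n → f k ≈ g k) → Σ≤ n f ≈ Σ≤ n g
  sum-cong zero    f≈g = f≈g 0 z≤n
  sum-cong (suc n) f≈g =
    +-cong (sum-cong n (λ k k≤n → f≈g k (NP.m≤n⇒m≤1+n k≤n))) (f≈g (suc n) NP.≤-refl)

  sum-zero : ∀ n {f} → (∀ k → k ≤ n → f k ≈ 0#) → Σ≤ n f ≈ 0#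
  sum-zero zero    f≈0 = f≈0 0 z≤n
  sum-zero (suc n) f≈0 =
    trans (+-cong (sum-zero n (λ k k≤n → f≈0 k (NP.m≤n⇒m≤1+n k≤n))) (f≈0 (suc n) NP.≤-refl))
          (+-identityˡ 0#)

  sum-+ : ∀ n f g → Σ≤ n (λ k → f k ⊕ g k) ≈ Σ≤ n f ⊕ Σ≤ n g
  sum-+ zero    f g = refl
  sum-+ (suc n) f g =
    trans (+-cong (sum-+ n f g) refl) (interchange (Σ≤ n f) (Σ≤ n g) (f (suc n)) (g (suc n)))

  sum-*ˡ : ∀ n a f → a ⊛ Σ≤ n f ≈ Σ≤ n (λ k → a ⊛ f k)
  sum-*ˡ zero    a f = refl
  sum-*ˡ (suc n) a f = trans (distribˡ a (Σ≤ n f) (f (suc n))) (+-cong (sum-*ˡ n a f) refl)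

  sum-×ˡ : ∀ n m f → m × Σ≤ n f ≈ Σ≤ n (λ k → m × f k)
  sum-×ˡ zero    m f = refl
  sum-×ˡ (suc n) m f = trans (×-distrib-+ (Σ≤ n f) (f (suc n)) m) (+-cong (sum-×ˡ n m f) refl)

  sum-swap : ∀ n m (f : ℕ → ℕ → Carrier) →
             Σ≤ n (λ i → Σ≤ m (λ j → f i j)) ≈ Σ≤ m (λ j → Σ≤ n (λ i → f i j))
  sum-swap zero    m f = refl
  sum-swap (suc n) m f =
    trans (+-cong (sum-swap n m f) refl) (sym (sum-+ m (λ j → Σ≤ n (λ i → f i j)) (f (suc n))))

  sum-uncons : ∀ n f → Σ≤ (suc n) f ≈ f 0 ⊕ Σ≤ n (λ k → f (suc k))
  sum-uncons zero    f = refl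
  sum-uncons (suc n) f = trans (+-cong (sum-uncons n f) refl) (+-assoc _ _ _)

  sum-dropZeros : ∀ n r f → (∀ k → k < r → f k ≈ 0#) → Σ≤ (n N.+ r) f ≈ Σ≤ n (λ j → f (j N.+ r))
  sum-dropZeros zero    zero    f f≈0 = refl
  sum-dropZeros zero    (suc r) f f≈0 =
    trans (+-cong (sum-zero r (λ k k≤r → f≈0 k (s≤s k≤r))) refl) (+-identityˡ _)
  sum-dropZeros (suc n) r       f f≈0 = +-cong (sum-dropZeros n r f f≈0) refl

  sum-padZeros : ∀ k n f → k ≤ n → (∀ j → k < j → f j ≈ 0#) → Σ≤ n f ≈ Σ≤ k f
  sum-padZeros k n f k≤n f≈0 = P.subst (λ m → Σ≤ m f ≈ Σ≤ k f) (NP.m+[n∸m]≡n k≤n) (pad (n ∸ k))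
    where
    pad : ∀ d → Σ≤ (k N.+ d) f ≈ Σ≤ k f
    pad zero    = P.subst (λ m → Σ≤ m f ≈ Σ≤ k f) (P.sym (NP.+-identityʳ k)) refl
    pad (suc d) = P.subst (λ m → Σ≤ m f ≈ Σ≤ k f) (P.sym (NP.+-suc k d))
      (trans (+-cong (pad d) (f≈0 (suc (k N.+ d)) (s≤s (NP.m≤m+n k d)))) (+-identityʳ _))

  sum-×-natural : ∀ n (f : ℕ → ℕ) y → Σ≤ n (λ k → f k × y) ≈ sumTo NP.+-*-commutativeSemiring n f × y
  sum-×-natural zero    f y = refl
  sum-×-natural (suc n) f y =
    trans (+-cong (sum-×-natural n f y) refl)
          (sym (×-homo-+ y (sumTo NP.+-*-commutativeSemiring n f) (f (suc n))))

module Combinatorics where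
  open N using (zero; _^_; _<_; s≤s; _<ᵇ_)
  open import Data.Nat.Combinatorics using (nCk+nC[k+1]≡[n+1]C[k+1]; k>n⇒nCk≡0)
  open import Data.Bool using (false)
  open import Data.Nat.Solver using (module +-*-Solver)
  open +-*-Solver
  open P using (refl; sym; trans; cong; cong₂)
  open P.≡-Reasoning
  open FiniteSums NP.+-*-commutativeSemiring

  binomialTransform : ℕ → ℕ → (ℕ → ℕ) → ℕ
  binomialTransform r n a = Σ≤ n (λ k → ((n C k) * r ^ (n ∸ k)) * a k)

  -- Pascal's rule turns the transform into a first-order recurrence in n.
  binomialTransform-suc : ∀ r n a →
    binomialTransform r (suc n) a ≡ r * binomialTransform r n a + binomialTransform r n (λ k → a (suc k))
  binomialTransform-suc r n a = begin
    binomialTransform r (suc n) a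
      ≡⟨ sum-uncons n (λ k → ((suc n C k) * r ^ (suc n ∸ k)) * a k) ⟩
    t 0 + Σ≤ n (λ k → ((suc n C suc k) * r ^ (n ∸ k)) * a (suc k))
      ≡⟨ cong (t 0 +_) (sum-cong n (λ k _ → pascal k)) ⟩
    t 0 + Σ≤ n (λ k → ((n C k) * r ^ (n ∸ k)) * a (suc k) + t (suc k))
      ≡⟨ cong (t 0 +_) (sum-+ n _ _) ⟩
    t 0 + (binomialTransform r n (λ k → a (suc k)) + Σ≤ n (λ k → t (suc k)))
      ≡⟨ solve 3 (λ u v w → u :+ (v :+ w) := (u :+ w) :+ v) refl (t 0) _ _ ⟩
    (t 0 + Σ≤ n (λ k → t (suc k))) + binomialTransform r n (λ k → a (suc k))
      ≡⟨ cong (_+ binomialTransform r n (λ k → a (suc k))) t-sum ⟩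
    r * binomialTransform r n a + binomialTransform r n (λ k → a (suc k)) ∎
    where
    t : ℕ → ℕ
    t k = ((n C k) * r ^ (suc n ∸ k)) * a k

    pascal : ∀ k → ((suc n C suc k) * r ^ (n ∸ k)) * a (suc k) ≡ ((n C k) * r ^ (n ∸ k)) * a (suc k) + t (suc k)
    pascal k = begin
      ((suc n C suc k) * r ^ (n ∸ k)) * a (suc k)
        ≡⟨ cong (λ z → (z * r ^ (n ∸ k)) * a (suc k)) (sym (nCk+nC[k+1]≡[n+1]C[k+1] n k)) ⟩
      (((n C k) + (n C suc k)) * r ^ (n ∸ k)) * a (suc k)
        ≡⟨ solve 4 (λ u v p q → ((u :+ v) :* p) :* q := (u :* p) :* q :+ (v :* p) :* q) refl
                   (n C k) (n C suc k) (r ^ (n ∸ k)) (a (suc k)) ⟩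
      ((n C k) * r ^ (n ∸ k)) * a (suc k) + t (suc k) ∎

    -- the term t (n+1) vanishes since C(n,n+1) = 0
    t-sum : t 0 + Σ≤ n (λ k → t (suc k)) ≡ r * binomialTransform r n a
    t-sum = begin
      t 0 + Σ≤ n (λ k → t (suc k)) ≡⟨ sym (sum-uncons n t) ⟩
      Σ≤ n t + t (suc n)
        ≡⟨ cong (λ z → Σ≤ n t + (z * r ^ (n ∸ n)) * a (suc n)) (k>n⇒nCk≡0 (NP.n<1+n n)) ⟩
      Σ≤ n t + 0 ≡⟨ NP.+-identityʳ _ ⟩
      Σ≤ n t
        ≡⟨ sum-cong n (λ k k≤n → trans (cong (λ z → ((n C k) * r ^ z) * a k) (NP.+-∸-assoc 1 k≤n))
             (solve 4 (λ u v p q → (u :* (v :* p)) :* q := v :* ((u :* p) :* q)) refl (n C k) r (r ^ (n ∸ k)) (a k))) ⟩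
      Σ≤ n (λ k → r * (((n C k) * r ^ (n ∸ k)) * a k)) ≡⟨ sym (sum-*ˡ n r _) ⟩
      r * binomialTransform r n a ∎

  binomialTransform-linear : ∀ r n a b m →
    binomialTransform r n (λ k → a k + m * b k) ≡ binomialTransform r n a + m * binomialTransform r n b
  binomialTransform-linear r n a b m = begin
    binomialTransform r n (λ k → a k + m * b k)
      ≡⟨ sum-cong n (λ k _ → solve 4 (λ w p q m → w :* (p :+ m :* q) := w :* p :+ m :* (w :* q)) refl
                                    ((n C k) * r ^ (n ∸ k)) (a k) (b k) m) ⟩
    Σ≤ n (λ k → ((n C k) * r ^ (n ∸ k)) * a k + m * (((n C k) * r ^ (n ∸ k)) * b k))
      ≡⟨ sum-+ n _ _ ⟩
    binomialTransform r n a + Σ≤ n (λ k → m * (((n C k) * r ^ (n ∸ k)) * b k))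
      ≡⟨ cong (binomialTransform r n a +_) (sym (sum-*ˡ n m _)) ⟩
    binomialTransform r n a + m * binomialTransform r n b ∎

  binomialTransform-zero : ∀ r n → binomialTransform r n (λ _ → 0) ≡ 0
  binomialTransform-zero r n = sum-zero n (λ k _ → NP.*-zeroʳ ((n C k) * r ^ (n ∸ k)))

  stirlingTransform : ℕ → ℕ → ℕ → ℕ
  stirlingTransform r n j = binomialTransform r n (λ k → stirling k j)

  stirlingTransform-suc-zero : ∀ r n → stirlingTransform r (suc n) 0 ≡ r * stirlingTransform r n 0
  stirlingTransform-suc-zero r n = begin
    stirlingTransform r (suc n) 0 ≡⟨ binomialTransform-suc r n _ ⟩
    r * stirlingTransform r n 0 + binomialTransform r n (λ _ → 0)
      ≡⟨ cong (r * stirlingTransform r n 0 +_) (binomialTransform-zero r n) ⟩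
    r * stirlingTransform r n 0 + 0 ≡⟨ NP.+-identityʳ _ ⟩
    r * stirlingTransform r n 0 ∎

  stirlingTransform-suc-suc : ∀ r n j →
    stirlingTransform r (suc n) (suc j) ≡ stirlingTransform r n j + (suc j + r) * stirlingTransform r n (suc j)
  stirlingTransform-suc-suc r n j = begin
    stirlingTransform r (suc n) (suc j) ≡⟨ binomialTransform-suc r n _ ⟩
    r * stirlingTransform r n (suc j) + binomialTransform r n (λ k → stirling k j + suc j * stirling k (suc j))
      ≡⟨ cong (r * stirlingTransform r n (suc j) +_) (binomialTransform-linear r n _ _ (suc j)) ⟩
    r * stirlingTransform r n (suc j) + (stirlingTransform r n j + suc j * stirlingTransform r n (suc j))
      ≡⟨ solve 4 (λ r u v s → r :* v :+ (u :+ s :* v) := u :+ (s :+ r) :* v) refl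
                 r (stirlingTransform r n j) (stirlingTransform r n (suc j)) (suc j) ⟩
    stirlingTransform r n j + (suc j + r) * stirlingTransform r n (suc j) ∎

  -- {m+r k}_r = 0 for k < r: the elements 1..r lie in distinct blocks.
  rStirlingAux-below : ∀ r m k → k < r → rStirlingAux r m k ≡ 0
  rStirlingAux-below r zero k k<r = δ-below k r k<r
    where
    δ-below : ∀ k r → k < r → δ k r ≡ 0
    δ-below zero    (suc r) _         = refl
    δ-below (suc k) (suc r) (s≤s k<r) = δ-below k r k<r
  rStirlingAux-below r (suc m) zero    k<r = refl
  rStirlingAux-below r (suc m) (suc k) k<r =
    trans (cong₂ (λ u v → u + suc k * v) (rStirlingAux-below r m k (NP.<-trans (NP.n<1+n k) k<r))
                                        (rStirlingAux-below r m (suc k) k<r))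
          (NP.*-zeroʳ (suc k))

  δ-offset : ∀ j r → δ (j + r) r ≡ stirling 0 j
  δ-offset zero    zero    = refl
  δ-offset (suc j) zero    = refl
  δ-offset j       (suc r) = trans (cong (λ z → δ z (suc r)) (NP.+-suc j r)) (δ-offset j r)

  rStirlingAux-transform : ∀ r m j → rStirlingAux r m (j + r) ≡ stirlingTransform r m j
  rStirlingAux-transform r zero j = trans (δ-offset j r) (sym (NP.*-identityˡ _))
  rStirlingAux-transform r (suc m) (suc j) =
    trans (cong₂ (λ u v → u + suc (j + r) * v) (rStirlingAux-transform r m j) (rStirlingAux-transform r m (suc j)))
          (sym (stirlingTransform-suc-suc r m j))
  rStirlingAux-transform zero (suc m) zero = sym (stirlingTransform-suc-zero zero m)
  rStirlingAux-transform (suc r) (suc m) zero =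
    trans (cong₂ (λ u v → u + suc r * v) (rStirlingAux-below (suc r) m r (NP.n<1+n r))
                                        (rStirlingAux-transform (suc r) m zero))
          (sym (stirlingTransform-suc-zero (suc r) m))

  n+r≮ᵇr : ∀ n r → (n + r <ᵇ r) ≡ false
  n+r≮ᵇr zero    zero    = refl
  n+r≮ᵇr (suc n) zero    = refl
  n+r≮ᵇr n       (suc r) = trans (cong (_<ᵇ suc r) (NP.+-suc n r)) (n+r≮ᵇr n r)

  rStirling-shift : ∀ n r k → rStirling r (n + r) k ≡ rStirlingAux r n k
  rStirling-shift n r k rewrite n+r≮ᵇr n r | NP.m+n∸n≡m n r = refl

  rStirling-below : ∀ n r k → k < r → rStirling r (n + r) k ≡ 0
  rStirling-below n r k k<r = trans (rStirling-shift n r k) (rStirlingAux-below r n k k<r)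

  rStirling-binomial : ∀ n r j → rStirling r (n + r) (j + r) ≡ stirlingTransform r n j
  rStirling-binomial n r j = trans (rStirling-shift n r (j + r)) (rStirlingAux-transform r n j)

  stirling-above : ∀ k j → k < j → stirling k j ≡ 0
  stirling-above zero    (suc j) _         = refl
  stirling-above (suc k) (suc j) (s≤s k<j) =
    trans (cong₂ (λ u v → u + suc j * v) (stirling-above k j k<j)
                                         (stirling-above k (suc j) (NP.<-trans k<j (NP.n<1+n j))))
          (NP.*-zeroʳ (suc j))

  factorial-rising : ∀ r j → r ! * rising (suc r) j ≡ (j + r) !
  factorial-rising r zero    = NP.*-identityʳ _
  factorial-rising r (suc j) = begin
    r ! * (rising (suc r) j * (suc r + j))
      ≡⟨ solve 3 (λ u v w → u :* (v :* w) := w :* (u :* v)) refl (r !) (rising (suc r) j) (suc r + j) ⟩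
    (suc r + j) * (r ! * rising (suc r) j)
      ≡⟨ cong₂ _*_ (cong suc (NP.+-comm r j)) (factorial-rising r j) ⟩
    (suc j + r) ! ∎

open Combinatorics using (stirlingTransform; rStirling-below; rStirling-binomial; stirling-above; factorial-rising)

module CoefficientComparison {c ℓ : Level} (R : CommutativeSemiring c ℓ) (n r : ℕ) (x : CommutativeSemiring.Carrier R) where
  open CommutativeSemiring R renaming (_+_ to _⊕_; _*_ to _⊛_)
  open RS rawSemiring using (_×_; _^_)
  open import Relation.Binary.Reasoning.Setoid setoid
  open import Algebra.Properties.Semiring.Mult semiring using (×-comm-*; ×-assocˡ; ×-congˡ; ×-congʳ)
  open import Algebra.Properties.Semiring.Exp semiring using (^-homo-*; ^-congʳ)
  open import Data.Nat.Solver using (module +-*-Solver)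
  open +-*-Solver using (solve; _:*_; _:=_)
  open FiniteSums R

  weight : ℕ → ℕ
  weight k = (n C k) * (r N.^ (n ∸ k))

  coefficient : ℕ → ℕ
  coefficient j = stirlingTransform r n j * (j + r) !

  lhs-expansion : rGeomF R r (n + r) x ≈ Σ≤ n (λ j → coefficient j × (x ^ (j + r)))
  lhs-expansion = begin
    rGeomF R r (n + r) x
      ≈⟨ sum-dropZeros n r _ (λ k k<r → reflexive (P.cong (λ z → (z * k !) × (x ^ k)) (rStirling-below n r k k<r))) ⟩
    Σ≤ n (λ j → (rStirling r (n + r) (j + r) * (j + r) !) × (x ^ (j + r)))
      ≈⟨ sum-cong n (λ j _ → ×-congˡ (P.cong (_* (j + r) !) (rStirling-binomial n r j))) ⟩
    Σ≤ n (λ j → coefficient j × (x ^ (j + r))) ∎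

  entry : ℕ → ℕ → ℕ
  entry k j = weight k * (stirling k j * rising (suc r) j)

  -- Each weighted F_{k,r+1}(x) is a full row of the double sum, since {k j} = 0 for j > k.
  weighted-geomF : ∀ k → k N.≤ n → weight k × geomF R k (suc r) x ≈ Σ≤ n (λ j → entry k j × (x ^ j))
  weighted-geomF k k≤n = begin
    weight k × geomF R k (suc r) x
      ≈⟨ sum-×ˡ k (weight k) _ ⟩
    Σ≤ k (λ j → weight k × ((stirling k j * rising (suc r) j) × (x ^ j)))
      ≈⟨ sum-cong k (λ j _ → ×-assocˡ (x ^ j) (weight k) _) ⟩
    Σ≤ k (λ j → entry k j × (x ^ j))
      ≈⟨ sym (sum-padZeros k n _ k≤n (λ j k<j → reflexive (P.cong (_× (x ^ j)) (entry-above j k<j)))) ⟩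
    Σ≤ n (λ j → entry k j × (x ^ j)) ∎
    where
    entry-above : ∀ j → k N.< j → entry k j ≡ 0
    entry-above j k<j = P.trans (P.cong (λ z → weight k * (z * rising (suc r) j)) (stirling-above k j k<j))
                                (NP.*-zeroʳ (weight k))

  columnSum : ℕ → ℕ
  columnSum j = sumTo NP.+-*-commutativeSemiring n (λ k → entry k j)

  columnSum-coefficient : ∀ j → r ! * columnSum j ≡ coefficient j
  columnSum-coefficient j = P.trans (P.cong (r ! *_) factor-rising) (P.trans reorder (P.cong (stirlingTransform r n j *_) (factorial-rising r j)))
    where
    module ℕΣ = FiniteSums NP.+-*-commutativeSemiring
    factor-rising : columnSum j ≡ rising (suc r) j * stirlingTransform r n j
    factor-rising = P.trans (ℕΣ.sum-cong n (λ k _ → solve 3 (λ a b c → a :* (b :* c) := c :* (a :* b)) P.refl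
                                                           (weight k) (stirling k j) (rising (suc r) j)))
                            (P.sym (ℕΣ.sum-*ˡ n (rising (suc r) j) _))
    reorder : r ! * (rising (suc r) j * stirlingTransform r n j) ≡ stirlingTransform r n j * (r ! * rising (suc r) j)
    reorder = solve 3 (λ a b c → a :* (b :* c) := c :* (a :* b)) P.refl (r !) (rising (suc r) j) (stirlingTransform r n j)

  shift-power : ∀ m j → x ^ r ⊛ (m × (x ^ j)) ≈ m × (x ^ (j + r))
  shift-power m j = trans (×-comm-* m (x ^ r) (x ^ j))
                          (×-congʳ m (trans (sym (^-homo-* x r j)) (^-congʳ x (NP.+-comm r j))))

  rhs-expansion : (r !) × (x ^ r ⊛ Σ≤ n (λ k → weight k × geomF R k (suc r) x))
                  ≈ Σ≤ n (λ j → coefficient j × (x ^ (j + r)))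
  rhs-expansion = begin
    (r !) × (x ^ r ⊛ Σ≤ n (λ k → weight k × geomF R k (suc r) x))
      ≈⟨ ×-congʳ (r !) (*-congˡ (sum-cong n weighted-geomF)) ⟩
    (r !) × (x ^ r ⊛ Σ≤ n (λ k → Σ≤ n (λ j → entry k j × (x ^ j))))
      ≈⟨ ×-congʳ (r !) (*-congˡ (sum-swap n n _)) ⟩
    (r !) × (x ^ r ⊛ Σ≤ n (λ j → Σ≤ n (λ k → entry k j × (x ^ j))))
      ≈⟨ ×-congʳ (r !) (*-congˡ (sum-cong n (λ j _ → sum-×-natural n _ (x ^ j)))) ⟩
    (r !) × (x ^ r ⊛ Σ≤ n (λ j → columnSum j × (x ^ j)))
      ≈⟨ ×-congʳ (r !) (trans (sum-*ˡ n (x ^ r) _) (sum-cong n (λ j _ → shift-power (columnSum j) j))) ⟩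
    (r !) × Σ≤ n (λ j → columnSum j × (x ^ (j + r)))
      ≈⟨ sum-×ˡ n (r !) _ ⟩
    Σ≤ n (λ j → (r !) × (columnSum j × (x ^ (j + r))))
      ≈⟨ sum-cong n (λ j _ → trans (×-assocˡ _ (r !) (columnSum j)) (×-congˡ (columnSum-coefficient j))) ⟩
    Σ≤ n (λ j → coefficient j × (x ^ (j + r))) ∎

mainTheorem7 : {c ℓ : Level} (R : CommutativeSemiring c ℓ) (n r : ℕ) (x : CommutativeSemiring.Carrier R) →
    CommutativeSemiring._≈_ R (rGeomF R r (n + r) x)
      (RS._×_ (CommutativeSemiring.rawSemiring R) (r !)
        (CommutativeSemiring._*_ R (RS._^_ (CommutativeSemiring.rawSemiring R) x r)
          (sumTo R n (λ k → RS._×_ (CommutativeSemiring.rawSemiring R) ((n C k) * (r N.^ (n ∸ k))) (geomF R k (suc r) x)))))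
mainTheorem7 R n r x = trans lhs-expansion (sym rhs-expansion)
  where
  open CommutativeSemiring R using (trans; sym)
  open CoefficientComparison R n r x using (lhs-expansion; rhs-expansion)
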